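{- For any game with activeness $G^g$ and any option $G'^{g'}\in G^g$, $G^g\neq G'^{g'}$.
   Context: Let $\mathcal{B}=\{0,1\}$. Define $\mathbb{I}_0=\{\emptyset\}\times\mathcal{B}$ and $\mathbb{I}_n=2^{\mathbb{I}_{n-1}}\times\mathcal{B}$ for $n\ge1$; a game with activeness is an element of $\mathbb{I}=\bigcup_{n\ge0}\mathbb{I}_n$. A pair $(G,g)$ is written $G^g$; elements of $G$ are its options, $g=1$ meaning active. The outcome $o$ is defined recursively: $o(G^g)=\mathscr{N}$ if $g=1$ and some option has outcome $\mathscr{P}$, and $o(G^g)=\mathscr{P}$ otherwise. The sum is $G^g+H^h=(\{G'^{g'}+H^h:G'^{g'}\in G^g\}\cup\{G^g+H'^{h'}:H'^{h'}\in H^h\})^{\max\{g,h\}}$. $G^g=H^h$ means $o(G^g+X^x)=o(H^h+X^x)$ for all games $X^x$; $G^g\ne H^h$ is its negation. -}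

module Defs where

open import Data.Bool using (Bool; true; false; _∨_)
open import Data.List using (List; []; _∷_; _++_)
open import Data.List.Membership.Propositional using (_∈_)
open import Relation.Binary.PropositionalEquality using (_≡_)
open import Relation.Nullary using (¬_)

-- A game with activeness G^g: a finite collection of options (games) and an
-- activeness bit g (true = active). Finite sets of games are represented by
-- lists; order/multiplicity are irrelevant for outcomes and sums below.
data Game : Set where
  mk : List Game → Bool → Game

options : Game → List Game
options (mk Gs _) = Gs

data Outcome : Set where
  𝒩 𝒫 : Outcome

mutual
  o : Game → Outcome
  o (mk Gs true)  = someP Gs
  o (mk Gs false) = 𝒫

  someP : List Game → Outcome
  someP [] = 𝒫
  someP (G ∷ Gs) with o G
  ... | 𝒫 = 𝒩
  ... | 𝒩 = someP Gs

mutual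
  infixl 6 _+_
  _+_ : Game → Game → Game
  G@(mk Gs g) + H@(mk Hs h) = mk (plusL Gs H ++ plusR G Hs) (g ∨ h)

  plusL : List Game → Game → List Game
  plusL [] H = []
  plusL (G' ∷ Gs) H = (G' + H) ∷ plusL Gs H

  plusR : Game → List Game → List Game
  plusR G [] = []
  plusR G (H' ∷ Hs) = (G + H') ∷ plusR G Hs

_≈_ : Game → Game → Set
G ≈ H = ∀ X → o (G + X) ≡ o (H + X)

_≉_ : Game → Game → Set
G ≉ H = ¬ (G ≈ H)

-- Let activate H be H with every position made active. In H + activate H the
-- second player copies each move into the other component, always reaching a
-- position of the form H' + activate H'; the opponent therefore moves only in
-- active positions that have such a 𝒫-option, so H + activate H is 𝒫.
-- If G' is an option of G, then G + activate G' is active and has the option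
-- G' + activate G', hence is 𝒩, while G' + activate G' is 𝒫: the game
-- activate G' distinguishes G from G'.
module Submission where

open import Defs
open import Data.Bool using (Bool; true; false)
open import Data.Bool.Properties using (∨-zeroʳ)
open import Data.List using (List; []; _∷_; _++_; map)
open import Data.List.Membership.Propositional using (_∈_)
open import Data.List.Membership.Propositional.Properties
  using (∈-map⁺; ∈-map⁻; ∈-++⁺ˡ; ∈-++⁺ʳ; ∈-++⁻)
open import Data.List.Relation.Unary.Any using (here; there)
open import Data.List.Relation.Unary.All as All using (All; []; _∷_)
open import Data.Product using (∃; _×_; _,_)
open import Data.Sum using (_⊎_; inj₁; inj₂)
open import Relation.Binary.PropositionalEquality
  using (_≡_; _≢_; refl; sym; subst; cong₂; module ≡-Reasoning)

activeness : Game → Bool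
activeness (mk _ g) = g

o-𝒩 : ∀ G {L} → activeness G ≡ true → L ∈ options G → o L ≡ 𝒫 → o G ≡ 𝒩
o-𝒩 (mk Gs true) refl = someP-𝒩
  where
  someP-𝒩 : ∀ {Ls L} → L ∈ Ls → o L ≡ 𝒫 → someP Ls ≡ 𝒩
  someP-𝒩 {L ∷ _} (here refl) oL≡𝒫 rewrite oL≡𝒫 = refl
  someP-𝒩 {L ∷ _} (there L∈Ls) oL≡𝒫 with o L
  ... | 𝒫 = refl
  ... | 𝒩 = someP-𝒩 L∈Ls oL≡𝒫

o-𝒫 : ∀ G → (∀ {L} → L ∈ options G → o L ≡ 𝒩) → o G ≡ 𝒫
o-𝒫 (mk Gs false) _ = refl
o-𝒫 (mk Gs true)  = someP-𝒫 Gs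
  where
  someP-𝒫 : ∀ Ls → (∀ {L} → L ∈ Ls → o L ≡ 𝒩) → someP Ls ≡ 𝒫
  someP-𝒫 []       _      = refl
  someP-𝒫 (L ∷ Ls) all-𝒩 with o L | all-𝒩 (here refl)
  ... | 𝒩 | _ = someP-𝒫 Ls (λ L∈Ls → all-𝒩 (there L∈Ls))

options-+ : ∀ G H → options (G + H) ≡ map (_+ H) (options G) ++ map (G +_) (options H)
options-+ G@(mk Gs _) H@(mk Hs _) = cong₂ _++_ (plusL≡map Gs) (plusR≡map Hs)
  where
  plusL≡map : ∀ Gs → plusL Gs H ≡ map (_+ H) Gs
  plusL≡map []        = refl
  plusL≡map (G' ∷ Gs) = cong₂ _∷_ refl (plusL≡map Gs)

  plusR≡map : ∀ Hs → plusR G Hs ≡ map (G +_) Hs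
  plusR≡map []        = refl
  plusR≡map (H' ∷ Hs) = cong₂ _∷_ refl (plusR≡map Hs)

∈-options-+ˡ : ∀ {G G'} H → G' ∈ options G → G' + H ∈ options (G + H)
∈-options-+ˡ {G} H G'∈G =
  subst (_ ∈_) (sym (options-+ G H)) (∈-++⁺ˡ (∈-map⁺ (_+ H) G'∈G))

∈-options-+ʳ : ∀ G {H H'} → H' ∈ options H → G + H' ∈ options (G + H)
∈-options-+ʳ G {H} H'∈H =
  subst (_ ∈_) (sym (options-+ G H)) (∈-++⁺ʳ _ (∈-map⁺ (G +_) H'∈H))

∈-options-+⁻ : ∀ G H {L} → L ∈ options (G + H) →
  (∃ λ G' → G' ∈ options G × L ≡ G' + H) ⊎ (∃ λ H' → H' ∈ options H × L ≡ G + H')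
∈-options-+⁻ G H L∈G+H
  with ∈-++⁻ (map (_+ H) (options G)) (subst (_ ∈_) (options-+ G H) L∈G+H)
... | inj₁ L∈left  = inj₁ (∈-map⁻ (_+ H) L∈left)
... | inj₂ L∈right = inj₂ (∈-map⁻ (G +_) L∈right)

mutual
  activate : Game → Game
  activate (mk Gs _) = mk (activateAll Gs) true

  activateAll : List Game → List Game
  activateAll []       = []
  activateAll (G ∷ Gs) = activate G ∷ activateAll Gs

activateAll≡map : ∀ Gs → activateAll Gs ≡ map activate Gs
activateAll≡map []       = refl
activateAll≡map (G ∷ Gs) = cong₂ _∷_ refl (activateAll≡map Gs)

∈-options-activate : ∀ {H H'} → H' ∈ options H → activate H' ∈ options (activate H)
∈-options-activate {mk Hs _} H'∈H =
  subst (_ ∈_) (sym (activateAll≡map Hs)) (∈-map⁺ activate H'∈H)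

∈-options-activate⁻ : ∀ H {X} → X ∈ options (activate H) →
  ∃ λ H' → H' ∈ options H × X ≡ activate H'
∈-options-activate⁻ (mk Hs _) X∈H =
  ∈-map⁻ activate (subst (_ ∈_) (activateAll≡map Hs) X∈H)

activeness-+-activate : ∀ G H → activeness (G + activate H) ≡ true
activeness-+-activate (mk _ g) (mk _ _) = ∨-zeroʳ g

reply-left-𝒩 : ∀ G {H'} → H' ∈ options G →
  o (H' + activate H') ≡ 𝒫 → o (G + activate H') ≡ 𝒩
reply-left-𝒩 G {H'} H'∈G =
  o-𝒩 (G + activate H') (activeness-+-activate G H')
    (∈-options-+ˡ {G} (activate H') H'∈G)

reply-right-𝒩 : ∀ H {H'} → H' ∈ options H →
  o (H' + activate H') ≡ 𝒫 → o (H' + activate H) ≡ 𝒩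
reply-right-𝒩 H {H'} H'∈H =
  o-𝒩 (H' + activate H) (activeness-+-activate H' H)
    (∈-options-+ʳ H' (∈-options-activate {H} H'∈H))

mutual
  mirror-𝒫 : ∀ H → o (H + activate H) ≡ 𝒫
  mirror-𝒫 H@(mk Hs _) = o-𝒫 (H + activate H) every-option-𝒩
    where
    every-option-𝒩 : ∀ {L} → L ∈ options (H + activate H) → o L ≡ 𝒩
    every-option-𝒩 L∈H+H with ∈-options-+⁻ H (activate H) L∈H+H
    ... | inj₁ (H' , H'∈H , refl) =
          reply-right-𝒩 H H'∈H (All.lookup (mirror-𝒫-all Hs) H'∈H)
    ... | inj₂ (X , X∈H , refl) with ∈-options-activate⁻ H X∈H
    ... | H' , H'∈H , refl =
          reply-left-𝒩 H H'∈H (All.lookup (mirror-𝒫-all Hs) H'∈H)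

  mirror-𝒫-all : ∀ Hs → All (λ H → o (H + activate H) ≡ 𝒫) Hs
  mirror-𝒫-all []       = []
  mirror-𝒫-all (H ∷ Hs) = mirror-𝒫 H ∷ mirror-𝒫-all Hs

theorem3p24 : (G G' : Game) → G' ∈ options G → G ≉ G'
theorem3p24 G G' G'∈G G≈G' = 𝒩≢𝒫 (begin
  𝒩                      ≡⟨ sym (reply-left-𝒩 G G'∈G (mirror-𝒫 G')) ⟩
  o (G + activate G')    ≡⟨ G≈G' (activate G') ⟩
  o (G' + activate G')   ≡⟨ mirror-𝒫 G' ⟩
  𝒫                      ∎)
  where
  open ≡-Reasoning
  𝒩≢𝒫 : 𝒩 ≢ 𝒫
  𝒩≢𝒫 ()
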